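{- Let $p\ge 3$. Then ${\rm gp}_{\rm d}(S_p^2)=p$, and $S_p^2$ has exactly one dual general position set of cardinality $p$.
   Context: For $p\ge 3$, $n\ge1$, the Sierpiński graph $S_p^n$ has vertex set $\{0,1,\dots,p-1\}^n$ (vertices written as words $i_1\cdots i_n$), and $i_1\cdots i_n$ is adjacent to $j_1\cdots j_n$ iff there is $h\in\{1,\dots,n\}$ with $i_t=j_t$ for all $t<h$, $i_h\ne j_h$, and $i_t=j_h$, $j_t=i_h$ for all $t>h$. For a graph $G$ and $X\subseteq V(G)$, vertices $u,v$ are $X$-positionable if every shortest $u,v$-path $P$ satisfies $V(P)\cap X\subseteq\{u,v\}$. $X$ is a dual general position set if any two vertices of $X$ are $X$-positionable and any two vertices of $V(G)\setminus X$ are $X$-positionable; ${\rm gp}_{\rm d}(G)$ is the maximum size of such a set. -}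

module Defs where

open import Data.Nat using (ℕ; zero; suc; _+_; _≤_; _<_)
open import Data.Fin using (Fin; toℕ)
open import Data.Vec using (Vec; []; _∷_; lookup)
open import Data.List using (List; []; _∷_; map; concatMap; length; [_])
open import Data.Nat.ListAction using (sum)
open import Data.List.Relation.Unary.Unique.Propositional using (Unique)
open import Data.List.Membership.Propositional using (_∈_)
open import Data.List using (allFin)
open import Data.Bool using (Bool; true; false; if_then_else_)
open import Data.Product using (Σ; ∃-syntax; _×_)
open import Data.Sum using (_⊎_)
open import Relation.Binary.PropositionalEquality using (_≡_; _≢_)

Vertex : ℕ → ℕ → Set
Vertex p n = Vec (Fin p) n

-- Adjacency in S_p^n, literally as in the definition (h is a 0-based index).
Adj : (p n : ℕ) → Vertex p n → Vertex p n → Set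
Adj p n i j = ∃[ h ] ((∀ t → toℕ t < toℕ h → lookup i t ≡ lookup j t)
                    × (lookup i h ≢ lookup j h)
                    × (∀ t → toℕ h < toℕ t → (lookup i t ≡ lookup j h) × (lookup j t ≡ lookup i h)))

data Walk (p n : ℕ) : Vertex p n → Vertex p n → Set where
  []  : ∀ {u} → Walk p n u u
  _∷_ : ∀ {u w v} → Adj p n u w → Walk p n w v → Walk p n u v

wlength : ∀ {p n u v} → Walk p n u v → ℕ
wlength []      = 0
wlength (_ ∷ w) = suc (wlength w)

verts : ∀ {p n u v} → Walk p n u v → List (Vertex p n)
verts {u = u} []      = u ∷ []
verts {u = u} (_ ∷ w) = u ∷ verts w

IsPath : ∀ {p n u v} → Walk p n u v → Set
IsPath w = Unique (verts w)

IsShortestPath : ∀ {p n u v} → Walk p n u v → Set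
IsShortestPath {p} {n} {u} {v} P =
  IsPath P × (∀ (Q : Walk p n u v) → IsPath Q → wlength P ≤ wlength Q)

VSubset : ℕ → ℕ → Set
VSubset p n = Vertex p n → Bool

Positionable : ∀ {p n} → VSubset p n → Vertex p n → Vertex p n → Set
Positionable {p} {n} X u v =
  ∀ (P : Walk p n u v) → IsShortestPath P →
    ∀ w → w ∈ verts P → X w ≡ true → (w ≡ u) ⊎ (w ≡ v)

IsDualGP : ∀ {p n} → VSubset p n → Set
IsDualGP {p} {n} X =
  (∀ u v → X u ≡ true  → X v ≡ true  → Positionable X u v) ×
  (∀ u v → X u ≡ false → X v ≡ false → Positionable X u v)

allVertices : (p n : ℕ) → List (Vertex p n)
allVertices p zero    = [ [] ]
allVertices p (suc n) = concatMap (λ x → map (x ∷_) (allVertices p n)) (allFin p)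

card : ∀ {p n} → VSubset p n → ℕ
card {p} {n} X = sum (map (λ v → if X v then 1 else 0) (allVertices p n))

-- The extreme vertices ii of S_p^2 are simplicial (their neighbourhood {ij | j ≠ i} is a
-- clique), so no shortest path passes through one of them: any set of extreme vertices is
-- a dual general position set. Conversely a dual general position set Y contains no
-- non-extreme vertex ij: otherwise one of the shortest paths ii–ij–ji, jj–ji–ij,
-- ii–ij–ji–jj, im–ij–ji, ij–im–mi, ji–ij–im–mi (m a third letter, so p ≥ 3) has both
-- ends on the same side of Y and its second vertex in Y. Hence every dual general position
-- set lies inside the p extreme vertices.
module Submission where

open import Defs
open import Data.Nat using (ℕ; _≤_)
open import Data.Product using (∃-syntax; _×_)
open import Relation.Binary.PropositionalEquality using (_≡_)

open import Data.Bool using (Bool; true; false; if_then_else_)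
open import Data.Empty using (⊥; ⊥-elim)
open import Data.Fin using (Fin; zero; suc; _≟_)
open import Data.List using (List; []; _∷_; [_]; _++_; map; concat; concatMap; tabulate; allFin; length)
open import Data.List.Membership.Propositional using (_∈_)
open import Data.List.Membership.Propositional.Properties using (∈-map⁺; ∈-concatMap⁺; ∈-allFin)
open import Data.List.Properties using (map-++; map-∘; map-cong; map-tabulate; length-tabulate; concat-map-[_])
open import Data.List.Relation.Binary.Subset.Propositional using (_⊆_)
open import Data.List.Relation.Unary.All as All using (All; []; _∷_)
open import Data.List.Relation.Unary.All.Properties using (anti-mono)
open import Data.List.Relation.Unary.AllPairs using ([]; _∷_)
open import Data.List.Relation.Unary.Any as Any using (here; there)
open import Data.Nat using (zero; suc; pred; _+_; _<_; z≤n; s≤s)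
open import Data.Nat.ListAction using (sum)
open import Data.Nat.ListAction.Properties using (sum-++)
open import Data.Nat.Properties using (≤-refl; ≤-trans; ≤-reflexive; m≤n⇒m≤1+n; <⇒≱; 1+n≰n)
open import Data.Product using (Σ; _,_; proj₁; proj₂)
open import Data.Sum using (_⊎_; inj₁; inj₂; [_,_]′)
open import Data.Vec using ([]; _∷_)
open import Function using (_∘_; id)
open import Relation.Binary.PropositionalEquality using (_≢_; refl; sym; trans; cong; subst; module ≡-Reasoning)
open import Relation.Nullary using (¬_; yes; no)
open import Relation.Nullary.Decidable using (⌊_⌋)

open ≡-Reasoning

countTrue : {A : Set} → (A → Bool) → List A → ℕ
countTrue f xs = sum (map (λ x → if f x then 1 else 0) xs)

countTrue-++ : {A : Set} (f : A → Bool) (xs ys : List A) →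
  countTrue f (xs ++ ys) ≡ countTrue f xs + countTrue f ys
countTrue-++ f xs ys = trans (cong sum (map-++ _ xs ys)) (sum-++ (map _ xs) _)

countTrue-concatMap : {A B : Set} (f : B → Bool) (g : A → List B) (xs : List A) →
  countTrue f (concatMap g xs) ≡ sum (map (countTrue f ∘ g) xs)
countTrue-concatMap f g []       = refl
countTrue-concatMap f g (x ∷ xs) =
  trans (countTrue-++ f (g x) (concatMap g xs))
        (cong (countTrue f (g x) +_) (countTrue-concatMap f g xs))

countTrue-map : {A B : Set} (f : B → Bool) (h : A → B) (xs : List A) →
  countTrue f (map h xs) ≡ countTrue (f ∘ h) xs
countTrue-map f h xs = cong sum (sym (map-∘ xs))

countTrue-none : {A : Set} (xs : List A) → countTrue (λ _ → false) xs ≡ 0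
countTrue-none []       = refl
countTrue-none (_ ∷ xs) = countTrue-none xs

countTrue-all : {A : Set} (xs : List A) → countTrue (λ _ → true) xs ≡ length xs
countTrue-all []       = refl
countTrue-all (_ ∷ xs) = cong suc (countTrue-all xs)

module _ {A : Set} {f g : A → Bool} (f⊆g : ∀ x → f x ≡ true → g x ≡ true) where

  countTrue-mono : (xs : List A) → countTrue f xs ≤ countTrue g xs
  countTrue-mono []       = z≤n
  countTrue-mono (x ∷ xs) with f x in fx | g x in gx
  ... | true  | true  = s≤s (countTrue-mono xs)
  ... | false | true  = m≤n⇒m≤1+n (countTrue-mono xs)
  ... | false | false = countTrue-mono xs
  ... | true  | false with () ← trans (sym (f⊆g x fx)) gx

  countTrue-≡⇒agree : (xs : List A) → countTrue f xs ≡ countTrue g xs →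
    ∀ {x} → x ∈ xs → f x ≡ g x
  countTrue-≡⇒agree (y ∷ xs) same y∈ with f y in fy | g y in gy
  ... | true  | false with () ← trans (sym (f⊆g y fy)) gy
  ... | false | true  = ⊥-elim (1+n≰n (subst (_≤ _) same (countTrue-mono xs)))
  countTrue-≡⇒agree (y ∷ xs) same (here refl) | true  | true  = trans fy (sym gy)
  countTrue-≡⇒agree (y ∷ xs) same (here refl) | false | false = trans fy (sym gy)
  countTrue-≡⇒agree (y ∷ xs) same (there x∈) | true  | true  =
    countTrue-≡⇒agree xs (cong pred same) x∈
  countTrue-≡⇒agree (y ∷ xs) same (there x∈) | false | false =
    countTrue-≡⇒agree xs same x∈

countTrue-cong : {A : Set} {f g : A → Bool} → (∀ x → f x ≡ g x) →
  (xs : List A) → countTrue f xs ≡ countTrue g xs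
countTrue-cong f≗g xs = cong sum (map-cong (λ x → cong (λ b → if b then 1 else 0) (f≗g x)) xs)

-- Not provable by refl: the two sides' `does` carry different `Dec` parameters.
⌊suc≟suc⌋ : ∀ {p} (a b : Fin p) → ⌊ suc a ≟ suc b ⌋ ≡ ⌊ a ≟ b ⌋
⌊suc≟suc⌋ a b with a ≟ b
... | yes _ = refl
... | no _  = refl

countTrue-allFin-suc : ∀ {p} (f : Fin (suc p) → Bool) →
  countTrue f (allFin (suc p)) ≡ (if f zero then 1 else 0) + countTrue (f ∘ suc) (allFin p)
countTrue-allFin-suc {p} f = cong ((if f zero then 1 else 0) +_) (begin
  countTrue f (tabulate suc)        ≡⟨ cong (countTrue f) (map-tabulate id suc) ⟨
  countTrue f (map suc (allFin p))  ≡⟨ countTrue-map f suc (allFin p) ⟩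
  countTrue (f ∘ suc) (allFin p)    ∎)

countTrue-allFin-≟ : ∀ {p} (a : Fin p) → countTrue (λ b → ⌊ a ≟ b ⌋) (allFin p) ≡ 1
countTrue-allFin-≟ {suc p} zero    =
  trans (countTrue-allFin-suc {p} (λ b → ⌊ zero ≟ b ⌋)) (cong suc (countTrue-none (allFin p)))
countTrue-allFin-≟ {suc p} (suc a) =
  trans (countTrue-allFin-suc {p} (λ b → ⌊ suc a ≟ b ⌋))
        (trans (countTrue-cong (⌊suc≟suc⌋ a) (allFin p)) (countTrue-allFin-≟ a))

∈-allVertices : ∀ {p n} (v : Vertex p n) → v ∈ allVertices p n
∈-allVertices []      = here refl
∈-allVertices {p} {suc n} (a ∷ v) =
  ∈-concatMap⁺ (λ x → map (x ∷_) (allVertices p n))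
    (Any.map (λ { refl → ∈-map⁺ (a ∷_) (∈-allVertices v) }) (∈-allFin a))

-- Adj is not injective, so the middle vertex of a walk step is given explicitly.
step : ∀ {p n u} w {v} → Adj p n u w → Walk p n w v → Walk p n u v
step w e W = e ∷ W

infixr 5 step
syntax step w e W = e ∷⟨ w ⟩ W

start∈verts : ∀ {p n u v} (W : Walk p n u v) → u ∈ verts W
start∈verts []      = here refl
start∈verts (_ ∷ _) = here refl

end∈verts : ∀ {p n u v} (W : Walk p n u v) → v ∈ verts W
end∈verts []      = here refl
end∈verts (_ ∷ W) = there (end∈verts W)

ShortestPath : (p n : ℕ) → Vertex p n → Vertex p n → Set
ShortestPath p n u v = Σ (Walk p n u v) IsShortestPath

Simplicial : ∀ {p n} → Vertex p n → Set
Simplicial {p} {n} w = ∀ {x y} → Adj p n x w → Adj p n w y → x ≢ y → Adj p n x y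

record Shortening {p n u v} (P : Walk p n u v) : Set where
  field
    walk      : Walk p n u v
    isPath    : IsPath walk
    shorter   : wlength walk < wlength P
    ⊆-verts   : verts walk ⊆ verts P

open Shortening

module _ {p n : ℕ} where

  prepend-shortening : ∀ {u x v} {P : Walk p n x v} (e : Adj p n u x) →
    All (u ≢_) (verts P) → Shortening P → Shortening {u = u} (e ∷ P)
  prepend-shortening e u∉P S = record
    { walk    = e ∷ walk S
    ; isPath  = anti-mono (⊆-verts S) u∉P ∷ isPath S
    ; shorter = s≤s (shorter S)
    ; ⊆-verts = λ { (here refl) → here refl ; (there y∈) → there (⊆-verts S y∈) }
    }

  bypass-simplicial : ∀ {u w x v} (e : Adj p n u w) (e′ : Adj p n w x) (P : Walk p n x v) →
    IsPath {u = u} (e ∷⟨ w ⟩ (e′ ∷ P)) → Simplicial w → Shortening {u = u} (e ∷⟨ w ⟩ (e′ ∷ P))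
  bypass-simplicial e e′ P (u∉ ∷ _ ∷ path) simplicial = record
    { walk    = simplicial e e′ (All.lookup u∉ (there (start∈verts P))) ∷ P
    ; isPath  = All.tail u∉ ∷ path
    ; shorter = ≤-refl
    ; ⊆-verts = λ { (here refl) → here refl ; (there y∈) → there (there y∈) }
    }

  shorten-at-simplicial : ∀ {u v w} (P : Walk p n u v) → IsPath P → Simplicial w →
    w ∈ verts P → w ≡ u ⊎ w ≡ v ⊎ Shortening P
  shorten-at-simplicial []       _ _ (here w≡u)         = inj₁ w≡u
  shorten-at-simplicial (_ ∷ _)  _ _ (here w≡u)         = inj₁ w≡u
  shorten-at-simplicial (_ ∷ []) _ _ (there (here w≡v)) = inj₂ (inj₁ w≡v)
  shorten-at-simplicial (e ∷ e′ ∷ P) path@(u∉ ∷ path′) simplicial (there w∈)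
    with shorten-at-simplicial (e′ ∷ P) path′ simplicial w∈
  ... | inj₁ refl       = inj₂ (inj₂ (bypass-simplicial e e′ P path simplicial))
  ... | inj₂ (inj₁ w≡v) = inj₂ (inj₁ w≡v)
  ... | inj₂ (inj₂ S)   = inj₂ (inj₂ (prepend-shortening e u∉ S))

  simplicial-positionable : {X : VSubset p n} → (∀ w → X w ≡ true → Simplicial w) →
    ∀ u v → Positionable X u v
  simplicial-positionable simplicial u v P (path , minimal) w w∈ Xw
    with shorten-at-simplicial P path (simplicial w Xw) w∈
  ... | inj₁ w≡u        = inj₁ w≡u
  ... | inj₂ (inj₁ w≡v) = inj₂ w≡v
  ... | inj₂ (inj₂ S)   = ⊥-elim (<⇒≱ (shorter S) (minimal (walk S) (isPath S)))

  simplicial-dualGP : {X : VSubset p n} → (∀ w → X w ≡ true → Simplicial w) → IsDualGP X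
  simplicial-dualGP simplicial =
    (λ u v _ _ → simplicial-positionable simplicial u v) ,
    (λ u v _ _ → simplicial-positionable simplicial u v)

  nonadjacent⇒2≤wlength : ∀ {u v} (W : Walk p n u v) → u ≢ v → ¬ Adj p n u v → 2 ≤ wlength W
  nonadjacent⇒2≤wlength []          u≢v _  = ⊥-elim (u≢v refl)
  nonadjacent⇒2≤wlength (e ∷ [])    _   ¬e = ⊥-elim (¬e e)
  nonadjacent⇒2≤wlength (_ ∷ _ ∷ _) _   _  = s≤s (s≤s z≤n)

  noCommonNeighbour⇒3≤wlength : ∀ {u v} (W : Walk p n u v) → u ≢ v → ¬ Adj p n u v →
    (∀ w → Adj p n u w → Adj p n w v → ⊥) → 3 ≤ wlength W
  noCommonNeighbour⇒3≤wlength []                         u≢v _  _  = ⊥-elim (u≢v refl)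
  noCommonNeighbour⇒3≤wlength (e ∷ [])                   _   ¬e _  = ⊥-elim (¬e e)
  noCommonNeighbour⇒3≤wlength (_∷_ {w = w} e (e′ ∷ [])) _   _  ¬∃ = ⊥-elim (¬∃ w e e′)
  noCommonNeighbour⇒3≤wlength (_ ∷ _ ∷ _ ∷ _)            _   _  _  = s≤s (s≤s (s≤s z≤n))

  sameSide-positionable : {X : VSubset p n} → IsDualGP X → ∀ {u v} → X u ≡ X v →
    Positionable X u v
  sameSide-positionable {X} (inside , outside) {u} {v} Xu≡Xv with X u in Xu
  ... | true  = inside  u v Xu (sym Xu≡Xv)
  ... | false = outside u v Xu (sym Xu≡Xv)

  interior∉dualGP : {X : VSubset p n} → IsDualGP X → ∀ {u v w} → X u ≡ X v →
    ((W , _) : ShortestPath p n u v) → w ∈ verts W → w ≢ u → w ≢ v → X w ≢ true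
  interior∉dualGP dual Xu≡Xv (W , shortest) w∈ w≢u w≢v Xw =
    [ w≢u , w≢v ]′ (sameSide-positionable dual Xu≡Xv W shortest _ w∈ Xw)

pattern ⟨_,_⟩ a b = a ∷ b ∷ []

module _ {p : ℕ} where

  Adj₂-inv : ∀ {a b c d : Fin p} → Adj p 2 ⟨ a , b ⟩ ⟨ c , d ⟩ →
    (a ≡ c × b ≢ d) ⊎ (a ≢ c × b ≡ c × d ≡ a)
  Adj₂-inv (zero , _ , a≢c , later) =
    inj₂ (a≢c , proj₁ (later (suc zero) (s≤s z≤n)) , proj₂ (later (suc zero) (s≤s z≤n)))
  Adj₂-inv (suc zero , earlier , b≢d , _) = inj₁ (earlier zero (s≤s z≤n) , b≢d)

  Adj-within : ∀ {a b d : Fin p} → b ≢ d → Adj p 2 ⟨ a , b ⟩ ⟨ a , d ⟩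
  Adj-within b≢d =
    suc zero , (λ { zero _ → refl ; (suc zero) (s≤s ()) }) , b≢d , λ { zero () ; (suc zero) (s≤s ()) }

  Adj-bridge : ∀ {a b : Fin p} → a ≢ b → Adj p 2 ⟨ a , b ⟩ ⟨ b , a ⟩
  Adj-bridge a≢b = zero , (λ _ ()) , a≢b , λ { (suc zero) _ → refl , refl }

  ≢-fst : ∀ {a b c d : Fin p} → a ≢ c → _≢_ {A = Vertex p 2} ⟨ a , b ⟩ ⟨ c , d ⟩
  ≢-fst a≢c refl = a≢c refl

  ≢-snd : ∀ {a b c d : Fin p} → b ≢ d → _≢_ {A = Vertex p 2} ⟨ a , b ⟩ ⟨ c , d ⟩
  ≢-snd b≢d refl = b≢d refl

Extreme : ∀ {p} → VSubset p 2
Extreme ⟨ a , b ⟩ = ⌊ a ≟ b ⌋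

module _ {p : ℕ} where

  extreme⇒diagonal : ∀ {a b : Fin p} → Extreme ⟨ a , b ⟩ ≡ true → a ≡ b
  extreme⇒diagonal {a} {b} ext with a ≟ b
  ... | yes a≡b = a≡b

  extreme-simplicial : ∀ w → Extreme {p} w ≡ true → Simplicial w
  extreme-simplicial ⟨ a , b ⟩ ext {⟨ x₁ , x₂ ⟩} {⟨ y₁ , y₂ ⟩} x~w w~y x≢y
    with extreme⇒diagonal ext
  ... | refl with Adj₂-inv x~w | Adj₂-inv w~y
  ... | inj₂ (x₁≢a , _ , a≡x₁) | _                       = ⊥-elim (x₁≢a (sym a≡x₁))
  ... | inj₁ _                 | inj₂ (a≢y₁ , a≡y₁ , _) = ⊥-elim (a≢y₁ a≡y₁)
  ... | inj₁ (refl , _)        | inj₁ (refl , _)        = Adj-within λ { refl → x≢y refl }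

allVertices-1 : ∀ p → allVertices p 1 ≡ map (_∷ []) (allFin p)
allVertices-1 p = begin
  concat (map (λ a → [ a ∷ [] ]) (allFin p))  ≡⟨ cong concat (map-∘ (allFin p)) ⟩
  concat (map [_] (map (_∷ []) (allFin p)))   ≡⟨ concat-map-[ map (_∷ []) (allFin p) ] ⟩
  map (_∷ []) (allFin p)                      ∎

card-Extreme : ∀ p → card {p} {2} Extreme ≡ p
card-Extreme p = begin
  countTrue Extreme (concatMap row (allFin p))    ≡⟨ countTrue-concatMap Extreme row (allFin p) ⟩
  sum (map (countTrue Extreme ∘ row) (allFin p))  ≡⟨ cong sum (map-cong row-count (allFin p)) ⟩
  countTrue (λ _ → true) (allFin p)               ≡⟨ countTrue-all (allFin p) ⟩
  length (allFin p)                               ≡⟨ length-tabulate id ⟩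
  p                                               ∎
  where
  row : Fin p → List (Vertex p 2)
  row a = map (a ∷_) (allVertices p 1)

  row-count : ∀ a → countTrue Extreme (row a) ≡ 1
  row-count a = begin
    countTrue Extreme (map (a ∷_) (allVertices p 1))
      ≡⟨ cong (countTrue Extreme ∘ map (a ∷_)) (allVertices-1 p) ⟩
    countTrue Extreme (map (a ∷_) (map (_∷ []) (allFin p)))
      ≡⟨ countTrue-map Extreme (a ∷_) (map (_∷ []) (allFin p)) ⟩
    countTrue (Extreme ∘ (a ∷_)) (map (_∷ []) (allFin p))
      ≡⟨ countTrue-map _ (_∷ []) (allFin p) ⟩
    countTrue (λ b → ⌊ a ≟ b ⌋) (allFin p)
      ≡⟨ countTrue-allFin-≟ a ⟩
    1 ∎

module _ {p : ℕ} where

  crossBridge : (i j k : Fin p) → i ≢ j → k ≢ j → ShortestPath p 2 ⟨ i , k ⟩ ⟨ j , i ⟩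
  crossBridge i j k i≢j k≢j =
    Adj-within k≢j ∷⟨ ⟨ i , j ⟩ ⟩ Adj-bridge i≢j ∷⟨ ⟨ j , i ⟩ ⟩ [] ,
    ((≢-snd k≢j ∷ ≢-fst i≢j ∷ []) ∷ (≢-fst i≢j ∷ []) ∷ [] ∷ []) ,
    λ W _ → nonadjacent⇒2≤wlength W (≢-fst i≢j) nonadjacent
    where
    nonadjacent : ¬ Adj p 2 ⟨ i , k ⟩ ⟨ j , i ⟩
    nonadjacent e with Adj₂-inv e
    ... | inj₁ (i≡j , _)     = i≢j i≡j
    ... | inj₂ (_ , k≡j , _) = k≢j k≡j

  extremeToExtreme : (i j : Fin p) → i ≢ j → ShortestPath p 2 ⟨ i , i ⟩ ⟨ j , j ⟩
  extremeToExtreme i j i≢j =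
    Adj-within i≢j ∷⟨ ⟨ i , j ⟩ ⟩ Adj-bridge i≢j ∷⟨ ⟨ j , i ⟩ ⟩ Adj-within i≢j ∷⟨ ⟨ j , j ⟩ ⟩ [] ,
    ((≢-snd i≢j ∷ ≢-fst i≢j ∷ ≢-fst i≢j ∷ []) ∷ (≢-fst i≢j ∷ ≢-fst i≢j ∷ []) ∷ (≢-snd i≢j ∷ []) ∷ [] ∷ []) ,
    λ W _ → noCommonNeighbour⇒3≤wlength W (≢-fst i≢j) nonadjacent noCommonNeighbour
    where
    nonadjacent : ¬ Adj p 2 ⟨ i , i ⟩ ⟨ j , j ⟩
    nonadjacent e with Adj₂-inv e
    ... | inj₁ (i≡j , _)     = i≢j i≡j
    ... | inj₂ (_ , i≡j , _) = i≢j i≡j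
    noCommonNeighbour : ∀ w → Adj p 2 ⟨ i , i ⟩ w → Adj p 2 w ⟨ j , j ⟩ → ⊥
    noCommonNeighbour ⟨ c , d ⟩ e₁ e₂ with Adj₂-inv e₁ | Adj₂-inv e₂
    ... | inj₂ (i≢c , i≡c , _) | _                  = i≢c i≡c
    ... | inj₁ (refl , _)      | inj₁ (i≡j , _)     = i≢j i≡j
    ... | inj₁ (refl , _)      | inj₂ (_ , _ , j≡i) = i≢j (sym j≡i)

  twoBridges : (i j m : Fin p) → i ≢ j → i ≢ m → j ≢ m → ShortestPath p 2 ⟨ j , i ⟩ ⟨ m , i ⟩
  twoBridges i j m i≢j i≢m j≢m =
    Adj-bridge (i≢j ∘ sym) ∷⟨ ⟨ i , j ⟩ ⟩ Adj-within j≢m ∷⟨ ⟨ i , m ⟩ ⟩ Adj-bridge i≢m ∷⟨ ⟨ m , i ⟩ ⟩ [] ,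
    ((≢-fst (i≢j ∘ sym) ∷ ≢-fst (i≢j ∘ sym) ∷ ≢-fst j≢m ∷ []) ∷ (≢-snd j≢m ∷ ≢-fst i≢m ∷ []) ∷
       (≢-fst i≢m ∷ []) ∷ [] ∷ []) ,
    λ W _ → noCommonNeighbour⇒3≤wlength W (≢-fst j≢m) nonadjacent noCommonNeighbour
    where
    nonadjacent : ¬ Adj p 2 ⟨ j , i ⟩ ⟨ m , i ⟩
    nonadjacent e with Adj₂-inv e
    ... | inj₁ (j≡m , _)     = j≢m j≡m
    ... | inj₂ (_ , i≡m , _) = i≢m i≡m
    noCommonNeighbour : ∀ w → Adj p 2 ⟨ j , i ⟩ w → Adj p 2 w ⟨ m , i ⟩ → ⊥
    noCommonNeighbour ⟨ c , d ⟩ e₁ e₂ with Adj₂-inv e₁ | Adj₂-inv e₂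
    ... | inj₁ (refl , _)        | inj₁ (j≡m , _)     = j≢m j≡m
    ... | inj₁ (refl , _)        | inj₂ (_ , _ , i≡j) = i≢j i≡j
    ... | inj₂ (_ , refl , refl) | inj₁ (i≡m , _)     = i≢m i≡m
    ... | inj₂ (_ , refl , refl) | inj₂ (_ , j≡m , _) = j≢m j≡m

avoid₂ : ∀ {q} (i j : Fin (3 + q)) → ∃[ m ] (m ≢ i × m ≢ j)
avoid₂ zero          zero          = suc zero , (λ ()) , (λ ())
avoid₂ zero          (suc zero)    = suc (suc zero) , (λ ()) , (λ ())
avoid₂ zero          (suc (suc _)) = suc zero , (λ ()) , (λ ())
avoid₂ (suc zero)    zero          = suc (suc zero) , (λ ()) , (λ ())
avoid₂ (suc zero)    (suc _)       = zero , (λ ()) , (λ ())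
avoid₂ (suc (suc _)) zero          = suc zero , (λ ()) , (λ ())
avoid₂ (suc (suc _)) (suc _)       = zero , (λ ()) , (λ ())

module _ {q : ℕ} {Y : VSubset (3 + q) 2} (dual : IsDualGP Y) where

  offDiagonal∉-bridgeInside : ∀ {i j} → i ≢ j → Y ⟨ i , j ⟩ ≡ true → Y ⟨ j , i ⟩ ≡ true → ⊥
  offDiagonal∉-bridgeInside {i} {j} i≢j Yij Yji with Y ⟨ i , i ⟩ in Yii | Y ⟨ j , j ⟩ in Yjj
  ... | true  | _     =
    interior∉dualGP dual (trans Yii (sym Yji)) (crossBridge i j i i≢j i≢j)
      (there (here refl)) (≢-snd (i≢j ∘ sym)) (≢-fst i≢j) Yij
  ... | false | true  =
    interior∉dualGP dual (trans Yjj (sym Yij)) (crossBridge j i j (i≢j ∘ sym) (i≢j ∘ sym))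
      (there (here refl)) (≢-snd i≢j) (≢-fst (i≢j ∘ sym)) Yji
  ... | false | false =
    interior∉dualGP dual (trans Yii (sym Yjj)) (extremeToExtreme i j i≢j)
      (there (here refl)) (≢-snd (i≢j ∘ sym)) (≢-fst i≢j) Yij

  offDiagonal∉-bridgeOutside : ∀ {i j} → i ≢ j → Y ⟨ i , j ⟩ ≡ true → Y ⟨ j , i ⟩ ≡ false → ⊥
  offDiagonal∉-bridgeOutside {i} {j} i≢j Yij Yji with avoid₂ i j
  ... | m , m≢i , m≢j with Y ⟨ i , m ⟩ in Yim | Y ⟨ m , i ⟩ in Ymi
  ... | false | _     =
    interior∉dualGP dual (trans Yim (sym Yji)) (crossBridge i j m i≢j m≢j)
      (there (here refl)) (≢-snd (m≢j ∘ sym)) (≢-fst i≢j) Yij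
  ... | true  | true  =
    interior∉dualGP dual (trans Yij (sym Ymi)) (crossBridge i m j (m≢i ∘ sym) (m≢j ∘ sym))
      (there (here refl)) (≢-snd m≢j) (≢-fst (m≢i ∘ sym)) Yim
  ... | true  | false =
    interior∉dualGP dual (trans Yji (sym Ymi)) (twoBridges i j m i≢j (m≢i ∘ sym) (m≢j ∘ sym))
      (there (here refl)) (≢-fst i≢j) (≢-fst (m≢i ∘ sym)) Yij

  offDiagonal∉ : ∀ {i j} → i ≢ j → Y ⟨ i , j ⟩ ≢ true
  offDiagonal∉ {i} {j} i≢j Yij with Y ⟨ j , i ⟩ in Yji
  ... | true  = offDiagonal∉-bridgeInside i≢j Yij Yji
  ... | false = offDiagonal∉-bridgeOutside i≢j Yij Yji

  dualGP⊆Extreme : ∀ v → Y v ≡ true → Extreme v ≡ true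
  dualGP⊆Extreme ⟨ a , b ⟩ Yv with a ≟ b
  ... | yes _   = refl
  ... | no a≢b = ⊥-elim (offDiagonal∉ a≢b Yv)

corollary3p4 : (p : ℕ) → 3 ≤ p →
    ∃[ X ] (IsDualGP {p} {2} X × card X ≡ p
    × (∀ (Y : VSubset p 2) → IsDualGP Y → card Y ≤ p)
    × (∀ (Y : VSubset p 2) → IsDualGP Y → card Y ≡ p → ∀ v → Y v ≡ X v))
corollary3p4 p@(suc (suc (suc _))) (s≤s (s≤s (s≤s _))) =
  Extreme , simplicial-dualGP extreme-simplicial , card-Extreme p ,
  (λ Y dual → ≤-trans (countTrue-mono (dualGP⊆Extreme dual) (allVertices p 2))
                      (≤-reflexive (card-Extreme p))) ,
  (λ Y dual cardY≡p v → countTrue-≡⇒agree (dualGP⊆Extreme dual) (allVertices p 2)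
                          (trans cardY≡p (sym (card-Extreme p))) (∈-allVertices v))
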